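{- Let $a,b$ be integers with $1\le a<b$. Let $p/q$ and $p'/q'$ be rational numbers in $[0,1]$ with $pq'-p'q=\pm1$ and $q\ge q'$. Then $$T(w_{(p+p')/(q+q')})=T(w_{p/q})\,T(w_{p'/q'})-(-1)^{q'}T(w_{(p-p')/(q-q')})$$ and $$T(w_{(p+p')/(q+q')})\ge T(w_{p/q})+1.$$
   Context: For $\theta\in[0,1]$, the mechanical word $\mathbf s_{\theta,0}=(s_n)_{n\ge1}$ over $\{a,b\}$ is given by $s_n=a$ if $\lfloor n\theta\rfloor-\lfloor (n-1)\theta\rfloor=0$ and $s_n=b$ otherwise. For a rational $p/q\in[0,1]$ in lowest terms, the lower Christoffel word $w_{p/q}$ is the prefix of length $q$ of $\mathbf s_{p/q,0}$ (e.g. $w_{0/1}=a$, $w_{1/1}=b$, $w_{1/2}=ab$, $w_{1/3}=aab$). By convention $w_{\pm1/0}$ is the empty word. For a finite word $v=v_1\ldots v_n$ over the positive integers, $T(v)=\mathrm{Tr}\left(\begin{pmatrix}v_1&1\\1&0\end{pmatrix}\cdots\begin{pmatrix}v_n&1\\1&0\end{pmatrix}\right)$, and $T$ of the empty word is $\mathrm{Tr}(I)=2$. -}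

module Defs where

open import Data.Nat as ℕ using (ℕ; zero; suc; _≟_)
open import Data.Nat.DivMod as ND using ()
open import Data.Integer as ℤ using (ℤ; +_)
open import Data.List using (List; []; _∷_; map)
open import Relation.Nullary.Decidable using (does)
open import Data.Bool using (if_then_else_)

data Letter : Set where
  𝕒 𝕓 : Letter

-- floor of n * (p / q) for q ≥ 1; for q = 0 we return 0 (never used in a
-- meaningful position: the Christoffel word of p/0 is empty by convention)
⌊_*_/_⌋ : ℕ → ℕ → ℕ → ℕ
⌊ n * p / zero ⌋ = 0
⌊ n * p / suc q ⌋ = ND._/_ (n ℕ.* p) (suc q)

-- n-th letter (n ≥ 1) of the mechanical word s_{p/q,0}:
-- a if ⌊nθ⌋ - ⌊(n-1)θ⌋ = 0, b otherwise
mechLetter : ℕ → ℕ → ℕ → Letter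
mechLetter p q n =
  if does (⌊ n * p / q ⌋ ≟ ⌊ (n ℕ.∸ 1) * p / q ⌋) then 𝕒 else 𝕓

mechFrom : ℕ → ℕ → ℕ → ℕ → List Letter
mechFrom p q m zero = []
mechFrom p q m (suc k) = mechLetter p q m ∷ mechFrom p q (suc m) k

-- lower Christoffel word w_{p/q}: prefix of length q of s_{p/q,0}
-- (for q = 0 this is the empty word, matching the convention w_{±1/0} = ε)
christoffel : ℕ → ℕ → List Letter
christoffel p q = mechFrom p q 1 q

record M2 : Set where
  constructor mat
  field
    m11 m12 m21 m22 : ℤ

_⊗_ : M2 → M2 → M2
mat a b c d ⊗ mat e f g h =
  mat (a ℤ.* e ℤ.+ b ℤ.* g) (a ℤ.* f ℤ.+ b ℤ.* h)
      (c ℤ.* e ℤ.+ d ℤ.* g) (c ℤ.* f ℤ.+ d ℤ.* h)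

I₂ : M2
I₂ = mat (+ 1) (+ 0) (+ 0) (+ 1)

tr : M2 → ℤ
tr (mat a _ _ d) = a ℤ.+ d

Mv : ℤ → M2
Mv v = mat v (+ 1) (+ 1) (+ 0)

prodM : List ℤ → M2
prodM [] = I₂
prodM (v ∷ vs) = Mv v ⊗ prodM vs

T : List ℤ → ℤ
T vs = tr (prodM vs)

subst : ℤ → ℤ → Letter → ℤ
subst a b 𝕒 = a
subst a b 𝕓 = b

Tw : ℤ → ℤ → ℕ → ℕ → ℤ
Tw a b p q = T (map (subst a b) (christoffel p q))

module Submission where

-- Lemma 4.3: traces of Christoffel words satisfy Fricke's relation along the
-- Farey tree.  Write M(w) for the matrix product of a word w under 𝕒 ↦ a,
-- 𝕓 ↦ b, so that T(w) = tr M(w).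
--
-- FareyWords: if x/y < x′/y′ are Farey neighbours (x′y − xy′ = 1) then
--   w_{(x+x′)/(y+y′)} = w_{x/y} w_{x′/y′}.  Letter by letter this is a
--   statement about floors, which reduces to one division lemma.
-- TraceMatrices: M is multiplicative, det M(w) = (−1)^|w|, Cayley–Hamilton
--   gives tr(CB²) = tr(CB) tr B − det B tr C, and the matrices M(w) of nonempty
--   words over positive integers lie in a cone on which the trace is ≥ 1,
--   does not decrease under multiplication, and is ≥ 3 on products.
-- The theorem: the determinant condition makes p/q, p′/q′ Farey neighbours.
--   If q′ = q then q = 1 and the mediant word is ab, checked directly.
--   Otherwise p/q is the mediant of c/d = (p−p′)/(q−q′) and p′/q′, so with
--   B = M(w_{p′/q′}), C = M(w_{c/d}), P = M(w_{p/q}) we have P = CB, Q = PB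
--   or P = BC, Q = BP for Q = M(w_{(p+p′)/(q+q′)}).  Fricke's relation with
--   det B = (−1)^{q′} is the identity; the inequality follows from
--   tr C ≤ tr P, tr B ≥ 1, and tr B ≥ 3 when q′ is even.

module FareyWords where

  open import Defs using (Letter; 𝕒; 𝕓; ⌊_*_/_⌋; mechLetter; mechFrom; christoffel)
  open import Data.Nat
  open import Data.Nat.Properties
  open import Data.Nat.DivMod
  open import Data.Nat.Divisibility using (_∣_; n∣m*n; ∣m+n∣m⇒∣n; ∣1⇒≡1)
  open import Data.Nat.Tactic.RingSolver using (solve)
  open import Data.List using ([]; _∷_; _++_; length)
  open import Relation.Binary.PropositionalEquality
  open import Relation.Nullary.Decidable using (does)
  open import Data.Bool using (if_then_else_)

  -- Farey neighbours: x/y < x′/y′ and x′y − xy′ = 1.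
  record Neighbours (x y x′ y′ : ℕ) : Set where
    constructor neighbours
    field cross : x′ * y ≡ suc (x * y′)

  div-transfer : ∀ N M e f y Y .{{_ : NonZero y}} .{{_ : NonZero Y}} →
    N * y + e ≡ M * Y + f → e ≤ f → f < Y → N / Y ≡ M / y
  div-transfer N M e f y Y eq e≤f f<Y = begin
    N / Y                   ≡⟨ m*n/o*n≡m/o N y Y ⟨
    N * y / (Y * y)         ≡⟨ /-congˡ Ny≡MY+r ⟩
    (M * Y + r) / (Y * y)   ≡⟨ m/n/o≡m/[n*o] (M * Y + r) Y y ⟨
    (M * Y + r) / Y / y     ≡⟨ /-congˡ MY+r/Y≡M ⟩
    M / y                   ∎
    where
    open ≡-Reasoning
    instance _ = m*n≢0 Y y
    r = f ∸ e
    Ny≡MY+r : N * y ≡ M * Y + r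
    Ny≡MY+r = +-cancelʳ-≡ e _ _ (begin
      N * y + e             ≡⟨ eq ⟩
      M * Y + f             ≡⟨ cong (M * Y +_) (m+[n∸m]≡n e≤f) ⟨
      M * Y + (e + r)       ≡⟨ cong (M * Y +_) (+-comm e r) ⟩
      M * Y + (r + e)       ≡⟨ +-assoc (M * Y) r e ⟨
      M * Y + r + e         ∎)
    MY+r/Y≡M : (M * Y + r) / Y ≡ M
    MY+r/Y≡M = begin
      (M * Y + r) / Y       ≡⟨ +-distrib-/-∣ˡ r (n∣m*n M) ⟩
      M * Y / Y + r / Y     ≡⟨ cong₂ _+_ (m*n/n≡m M Y) (m<n⇒m/n≡0 (≤-<-trans (m∸n≤m f e) f<Y)) ⟩
      M + 0                 ≡⟨ +-identityʳ M ⟩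
      M                     ∎

  -- The two cross-multiplied identities describing the floors along the word of
  -- the mediant (x + x′)/(y + y′): left block (positions n ≤ y) and right block
  -- (positions y + m with m ≤ y′).
  mediant-identityˡ : ∀ {x y x′ y′} n → Neighbours x y x′ y′ →
    n * (x + x′) * y + 0 ≡ n * x * (y + y′) + n
  mediant-identityˡ {x} {y} {x′} {y′} n nb = begin
    n * (x + x′) * y + 0          ≡⟨ solve (n ∷ x ∷ x′ ∷ y ∷ []) ⟩
    n * x * y + n * (x′ * y)      ≡⟨ cong (λ t → n * x * y + n * t) (Neighbours.cross nb) ⟩
    n * x * y + n * suc (x * y′)  ≡⟨ solve (n ∷ x ∷ y ∷ y′ ∷ []) ⟩
    n * x * (y + y′) + n          ∎
    where open ≡-Reasoning

  mediant-identityʳ : ∀ {x y x′ y′} m → Neighbours x y x′ y′ →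
    (y + m) * (x + x′) * y′ + m ≡ (m * x′ + x * y′) * (y + y′) + y′
  mediant-identityʳ {x} {y} {x′} {y′} m nb = begin
    (y + m) * (x + x′) * y′ + m
      ≡⟨ solve (x ∷ y ∷ x′ ∷ y′ ∷ m ∷ []) ⟩
    (x′ * y) * y′ + (x * y * y′ + m * x * y′ + m * x′ * y′ + m)
      ≡⟨ cong (λ t → t * y′ + (x * y * y′ + m * x * y′ + m * x′ * y′ + m)) (Neighbours.cross nb) ⟩
    suc (x * y′) * y′ + (x * y * y′ + m * x * y′ + m * x′ * y′ + m)
      ≡⟨ solve (x ∷ y ∷ y′ ∷ m ∷ x′ ∷ []) ⟩
    m * suc (x * y′) + (x * y * y′ + x * y′ * y′ + m * x′ * y′ + y′)
      ≡⟨ cong (λ t → m * t + (x * y * y′ + x * y′ * y′ + m * x′ * y′ + y′)) (Neighbours.cross nb) ⟨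
    m * (x′ * y) + (x * y * y′ + x * y′ * y′ + m * x′ * y′ + y′)
      ≡⟨ solve (x ∷ y ∷ x′ ∷ y′ ∷ m ∷ []) ⟩
    (m * x′ + x * y′) * (y + y′) + y′
      ∎
    where open ≡-Reasoning

  floor-left : ∀ {x y x′ y′} n → 1 ≤ y → 1 ≤ y′ → Neighbours x y x′ y′ → n ≤ y →
    ⌊ n * (x + x′) / (y + y′) ⌋ ≡ ⌊ n * x / y ⌋
  floor-left {x} {y@(suc _)} {x′} {y′@(suc _)} n (s≤s z≤n) (s≤s z≤n) nb n≤y =
    div-transfer (n * (x + x′)) (n * x) 0 n y (y + y′)
      (mediant-identityˡ n nb) z≤n (≤-<-trans n≤y (m<m+n y z<s))

  floor-right : ∀ {x y x′ y′} m → 1 ≤ y → 1 ≤ y′ → Neighbours x y x′ y′ → m ≤ y′ →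
    ⌊ (y + m) * (x + x′) / (y + y′) ⌋ ≡ x + ⌊ m * x′ / y′ ⌋
  floor-right {x} {y@(suc _)} {x′} {y′@(suc _)} m (s≤s z≤n) (s≤s z≤n) nb m≤y′ = begin
    (y + m) * (x + x′) / (y + y′)  ≡⟨ div-transfer ((y + m) * (x + x′)) (m * x′ + x * y′) m y′ y′ (y + y′)
                                         (mediant-identityʳ m nb) m≤y′ (m<n+m y′ z<s) ⟩
    (m * x′ + x * y′) / y′         ≡⟨ +-distrib-/-∣ʳ (m * x′) (n∣m*n x) ⟩
    m * x′ / y′ + x * y′ / y′      ≡⟨ cong (m * x′ / y′ +_) (m*n/n≡m x y′) ⟩
    m * x′ / y′ + x                ≡⟨ +-comm (m * x′ / y′) x ⟩
    x + m * x′ / y′                ∎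
    where open ≡-Reasoning

  -- The letter recorded by two consecutive floors: a when they agree, b otherwise;
  -- by definition  mechLetter p q n = letterOf ⌊ n * p / q ⌋ ⌊ (n ∸ 1) * p / q ⌋.
  letterOf : ℕ → ℕ → Letter
  letterOf u v = if does (u ≟ v) then 𝕒 else 𝕓

  letterOf-shift : ∀ k u v → letterOf (k + u) (k + v) ≡ letterOf u v
  letterOf-shift zero    u v = refl
  letterOf-shift (suc k) u v = letterOf-shift k u v

  mechLetter-left : ∀ {x y x′ y′} n → 1 ≤ y → 1 ≤ y′ → Neighbours x y x′ y′ → n ≤ y →
    mechLetter (x + x′) (y + y′) n ≡ mechLetter x y n
  mechLetter-left n y≥1 y′≥1 nb n≤y =
    cong₂ letterOf (floor-left n y≥1 y′≥1 nb n≤y)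
                   (floor-left (n ∸ 1) y≥1 y′≥1 nb (≤-trans (m∸n≤m n 1) n≤y))

  mechLetter-right : ∀ {x y x′ y′} m → 1 ≤ y → 1 ≤ y′ → Neighbours x y x′ y′ → 1 ≤ m → m ≤ y′ →
    mechLetter (x + x′) (y + y′) (y + m) ≡ mechLetter x′ y′ m
  mechLetter-right {x} {y} {x′} {y′} (suc m) y≥1 y′≥1 nb _ m<y′ = begin
    mechLetter (x + x′) (y + y′) (y + suc m)
      ≡⟨ cong₂ letterOf (floor-right (suc m) y≥1 y′≥1 nb m<y′) previous ⟩
    letterOf (x + ⌊ suc m * x′ / y′ ⌋) (x + ⌊ m * x′ / y′ ⌋)
      ≡⟨ letterOf-shift x _ _ ⟩
    mechLetter x′ y′ (suc m) ∎
    where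
    open ≡-Reasoning
    previous : ⌊ (y + suc m ∸ 1) * (x + x′) / (y + y′) ⌋ ≡ x + ⌊ m * x′ / y′ ⌋
    previous = trans (cong (λ k → ⌊ (k ∸ 1) * (x + x′) / (y + y′) ⌋) (+-suc y m))
                     (floor-right m y≥1 y′≥1 nb (<⇒≤ m<y′))

  mechFrom-++ : ∀ p q m k l → mechFrom p q m (k + l) ≡ mechFrom p q m k ++ mechFrom p q (m + k) l
  mechFrom-++ p q m zero    l = cong (λ i → mechFrom p q i l) (sym (+-identityʳ m))
  mechFrom-++ p q m (suc k) l = cong (mechLetter p q m ∷_) (begin
    mechFrom p q (suc m) (k + l)                              ≡⟨ mechFrom-++ p q (suc m) k l ⟩
    mechFrom p q (suc m) k ++ mechFrom p q (suc m + k) l      ≡⟨ cong (λ i → mechFrom p q (suc m) k ++ mechFrom p q i l) (+-suc m k) ⟨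
    mechFrom p q (suc m) k ++ mechFrom p q (m + suc k) l      ∎)
    where open ≡-Reasoning

  mechFrom-cong : ∀ {p q p′ q′} m m′ k →
    (∀ i → i < k → mechLetter p q (m + i) ≡ mechLetter p′ q′ (m′ + i)) →
    mechFrom p q m k ≡ mechFrom p′ q′ m′ k
  mechFrom-cong m m′ zero    agree = refl
  mechFrom-cong {p} {q} {p′} {q′} m m′ (suc k) agree = cong₂ _∷_
    (subst₂ (λ i j → mechLetter p q i ≡ mechLetter p′ q′ j) (+-identityʳ m) (+-identityʳ m′) (agree 0 z<s))
    (mechFrom-cong (suc m) (suc m′) k λ i i<k →
       subst₂ (λ u v → mechLetter p q u ≡ mechLetter p′ q′ v) (+-suc m i) (+-suc m′ i) (agree (suc i) (s<s i<k)))

  christoffel-mediant : ∀ {x y x′ y′} → 1 ≤ y → 1 ≤ y′ → Neighbours x y x′ y′ →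
    christoffel (x + x′) (y + y′) ≡ christoffel x y ++ christoffel x′ y′
  christoffel-mediant {x} {y} {x′} {y′} y≥1 y′≥1 nb = begin
    mechFrom (x + x′) (y + y′) 1 (y + y′)                                   ≡⟨ mechFrom-++ _ _ 1 y y′ ⟩
    mechFrom (x + x′) (y + y′) 1 y ++ mechFrom (x + x′) (y + y′) (1 + y) y′ ≡⟨ cong₂ _++_ left right ⟩
    christoffel x y ++ christoffel x′ y′                                     ∎
    where
    open ≡-Reasoning
    left : mechFrom (x + x′) (y + y′) 1 y ≡ christoffel x y
    left = mechFrom-cong 1 1 y λ i i<y → mechLetter-left (suc i) y≥1 y′≥1 nb i<y
    right : mechFrom (x + x′) (y + y′) (1 + y) y′ ≡ christoffel x′ y′
    right = mechFrom-cong (1 + y) 1 y′ λ i i<y′ →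
      trans (cong (mechLetter (x + x′) (y + y′)) (sym (+-suc y i)))
            (mechLetter-right (suc i) y≥1 y′≥1 nb (s≤s z≤n) i<y′)

  mechFrom-length : ∀ p q m k → length (mechFrom p q m k) ≡ k
  mechFrom-length p q m zero    = refl
  mechFrom-length p q m (suc k) = cong suc (mechFrom-length p q (suc m) k)

  neighbours-same-denominator : ∀ {x x′ y} → Neighbours x y x′ y → y ≡ 1
  neighbours-same-denominator {x} {x′} {y} (neighbours cross) =
    ∣1⇒≡1 (∣m+n∣m⇒∣n (subst (y ∣_) (trans cross (+-comm 1 (x * y))) (n∣m*n x′)) (n∣m*n x))

  neighbours-numeratorˡ : ∀ {p q p′ q′} → Neighbours p q p′ q′ → q′ ≤ q → 2 ≤ q → p′ ≤ p
  neighbours-numeratorˡ {p} {q} {p′} {q′} (neighbours cross) q′≤q q≥2 = s≤s⁻¹ (*-cancelʳ-< q p′ (suc p) (begin-strict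
    p′ * q        ≡⟨ cross ⟩
    suc (p * q′)  ≤⟨ s≤s (*-monoʳ-≤ p q′≤q) ⟩
    suc (p * q)   <⟨ +-monoˡ-< (p * q) q≥2 ⟩
    q + p * q     ∎))
    where open ≤-Reasoning

  neighbours-numeratorʳ : ∀ {p q p′ q′} → Neighbours p′ q′ p q → q′ ≤ q → p′ ≤ p
  neighbours-numeratorʳ {p} {q} {p′} {q′} (neighbours cross) q′≤q = <⇒≤ (*-cancelʳ-< q p′ p (begin-strict
    p′ * q        <⟨ n<1+n (p′ * q) ⟩
    suc (p′ * q)  ≡⟨ cross ⟨
    p * q′        ≤⟨ *-monoʳ-≤ p q′≤q ⟩
    p * q         ∎))
    where open ≤-Reasoning

  neighbours-cancelˡ : ∀ {c d x y} → Neighbours (c + x) (d + y) x y → Neighbours c d x y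
  neighbours-cancelˡ {c} {d} {x} {y} (neighbours cross) = neighbours (+-cancelʳ-≡ (x * y) _ _ (begin
    x * d + x * y        ≡⟨ *-distribˡ-+ x d y ⟨
    x * (d + y)          ≡⟨ cross ⟩
    suc ((c + x) * y)    ≡⟨ cong suc (*-distribʳ-+ y c x) ⟩
    suc (c * y) + x * y  ∎))
    where open ≡-Reasoning

  neighbours-cancelʳ : ∀ {c d x y} → Neighbours x y (c + x) (d + y) → Neighbours x y c d
  neighbours-cancelʳ {c} {d} {x} {y} (neighbours cross) = neighbours (+-cancelʳ-≡ (x * y) _ _ (begin
    c * y + x * y        ≡⟨ *-distribʳ-+ y c x ⟨
    (c + x) * y          ≡⟨ cross ⟩
    suc (x * (d + y))    ≡⟨ cong suc (*-distribˡ-+ x d y) ⟩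
    suc (x * d) + x * y  ∎))
    where open ≡-Reasoning

  neighbours-differenceˡ : ∀ {p q p′ q′} → Neighbours p q p′ q′ → p′ ≤ p → q′ ≤ q →
    Neighbours (p ∸ p′) (q ∸ q′) p′ q′
  neighbours-differenceˡ {p′ = p′} {q′} nb p′≤p q′≤q = neighbours-cancelˡ
    (subst₂ (λ x y → Neighbours x y p′ q′) (sym (m∸n+n≡m p′≤p)) (sym (m∸n+n≡m q′≤q)) nb)

  neighbours-differenceʳ : ∀ {p q p′ q′} → Neighbours p′ q′ p q → p′ ≤ p → q′ ≤ q →
    Neighbours p′ q′ (p ∸ p′) (q ∸ q′)
  neighbours-differenceʳ {p′ = p′} {q′} nb p′≤p q′≤q = neighbours-cancelʳ
    (subst₂ (λ x y → Neighbours p′ q′ x y) (sym (m∸n+n≡m p′≤p)) (sym (m∸n+n≡m q′≤q)) nb)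

module TraceMatrices where

  open import Defs using (M2; mat; _⊗_; I₂; tr; Mv; prodM)
  open import Data.Nat as ℕ using (z≤n; s≤s)
  import Data.Nat.Properties as ℕP
  open import Data.Integer using (ℤ; +_; -_; _+_; _-_; _*_; _^_; _≤_; +≤+)
  import Data.Integer.Properties as ℤP
  open import Data.Integer.Tactic.RingSolver using (solve-∀)
  open import Data.List using ([]; _∷_; _++_; length)
  open import Data.List.Relation.Unary.All using (All; []; _∷_)
  open import Relation.Binary.PropositionalEquality

  mat-≡ : ∀ {a b c d a′ b′ c′ d′} → a ≡ a′ → b ≡ b′ → c ≡ c′ → d ≡ d′ →
    mat a b c d ≡ mat a′ b′ c′ d′
  mat-≡ refl refl refl refl = refl

  assoc-entry : ∀ u v e f g h s t →
    (u * e + v * g) * s + (u * f + v * h) * t ≡ u * (e * s + f * t) + v * (g * s + h * t)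
  assoc-entry = solve-∀

  ⊗-assoc : ∀ A B C → (A ⊗ B) ⊗ C ≡ A ⊗ (B ⊗ C)
  ⊗-assoc (mat a b c d) (mat e f g h) (mat i j k l) = mat-≡
    (assoc-entry a b e f g h i k) (assoc-entry a b e f g h j l)
    (assoc-entry c d e f g h i k) (assoc-entry c d e f g h j l)

  unit-entryˡ : ∀ e g → + 1 * e + + 0 * g ≡ e
  unit-entryˡ = solve-∀

  unit-entryˡ′ : ∀ e g → + 0 * e + + 1 * g ≡ g
  unit-entryˡ′ = solve-∀

  unit-entryʳ : ∀ e f → e * + 1 + f * + 0 ≡ e
  unit-entryʳ = solve-∀

  unit-entryʳ′ : ∀ e f → e * + 0 + f * + 1 ≡ f
  unit-entryʳ′ = solve-∀

  ⊗-identityˡ : ∀ A → I₂ ⊗ A ≡ A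
  ⊗-identityˡ (mat a b c d) =
    mat-≡ (unit-entryˡ a c) (unit-entryˡ b d) (unit-entryˡ′ a c) (unit-entryˡ′ b d)

  ⊗-identityʳ : ∀ A → A ⊗ I₂ ≡ A
  ⊗-identityʳ (mat a b c d) =
    mat-≡ (unit-entryʳ a b) (unit-entryʳ′ a b) (unit-entryʳ c d) (unit-entryʳ′ c d)

  prodM-++ : ∀ us vs → prodM (us ++ vs) ≡ prodM us ⊗ prodM vs
  prodM-++ []       vs = sym (⊗-identityˡ (prodM vs))
  prodM-++ (u ∷ us) vs = trans (cong (Mv u ⊗_) (prodM-++ us vs)) (sym (⊗-assoc (Mv u) (prodM us) (prodM vs)))

  det : M2 → ℤ
  det (mat a b c d) = a * d - b * c

  det-identity : ∀ a b c d e f g h →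
    (a * e + b * g) * (c * f + d * h) - (a * f + b * h) * (c * e + d * g) ≡ (a * d - b * c) * (e * h - f * g)
  det-identity = solve-∀

  det-⊗ : ∀ A B → det (A ⊗ B) ≡ det A * det B
  det-⊗ (mat a b c d) (mat e f g h) = det-identity a b c d e f g h

  det-Mv-identity : ∀ v → v * + 0 - + 1 * + 1 ≡ - + 1
  det-Mv-identity = solve-∀

  det-prodM : ∀ vs → det (prodM vs) ≡ (- + 1) ^ length vs
  det-prodM []       = refl
  det-prodM (v ∷ vs) = begin
    det (Mv v ⊗ prodM vs)           ≡⟨ det-⊗ (Mv v) (prodM vs) ⟩
    det (Mv v) * det (prodM vs)     ≡⟨ cong₂ _*_ (det-Mv-identity v) (det-prodM vs) ⟩
    - + 1 * (- + 1) ^ length vs     ∎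
    where open ≡-Reasoning

  tr-identity : ∀ a b c d e f g h → (a * e + b * g) + (c * f + d * h) ≡ (e * a + f * c) + (g * b + h * d)
  tr-identity = solve-∀

  tr-comm : ∀ A B → tr (A ⊗ B) ≡ tr (B ⊗ A)
  tr-comm (mat a b c d) (mat e f g h) = tr-identity a b c d e f g h

  fricke-identity : ∀ x y z w a b c d →
    ((x * a + y * c) * a + (x * b + y * d) * c) + ((z * a + w * c) * b + (z * b + w * d) * d)
    ≡ ((x * a + y * c) + (z * b + w * d)) * (a + d) - (a * d - b * c) * (x + w)
  fricke-identity = solve-∀

  -- Cayley–Hamilton for B, multiplied by X and traced:
  -- tr(XB²) = tr(XB)·tr B − det B·tr X.
  fricke : ∀ X B → tr ((X ⊗ B) ⊗ B) ≡ tr (X ⊗ B) * tr B - det B * tr X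
  fricke (mat x y z w) (mat a b c d) = fricke-identity x y z w a b c d

  -- They contain every [[v, 1], [1, 0]] with v ≥ 1 and are closed under
  -- products, so every nonempty word over positive integers lands here.
  data Positive : M2 → Set where
    positive : ∀ {x y z w} → 1 ℕ.≤ x → 1 ℕ.≤ y → 1 ℕ.≤ z → z ℕ.≤ x → w ℕ.≤ y →
               Positive (mat (+ x) (+ y) (+ z) (+ w))

  ⊗-ℕ : ∀ x y z w x′ y′ z′ w′ →
    mat (+ x) (+ y) (+ z) (+ w) ⊗ mat (+ x′) (+ y′) (+ z′) (+ w′)
    ≡ mat (+ (x ℕ.* x′ ℕ.+ y ℕ.* z′)) (+ (x ℕ.* y′ ℕ.+ y ℕ.* w′))
          (+ (z ℕ.* x′ ℕ.+ w ℕ.* z′)) (+ (z ℕ.* y′ ℕ.+ w ℕ.* w′))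
  ⊗-ℕ x y z w x′ y′ z′ w′ =
    mat-≡ (entry x x′ y z′) (entry x y′ y w′) (entry z x′ w z′) (entry z y′ w w′)
    where
    entry : ∀ a b c d → + a * + b + + c * + d ≡ + (a ℕ.* b ℕ.+ c ℕ.* d)
    entry a b c d = sym (cong₂ _+_ (ℤP.pos-* a b) (ℤP.pos-* c d))

  1≤* : ∀ {m n} → 1 ℕ.≤ m → 1 ℕ.≤ n → 1 ℕ.≤ m ℕ.* n
  1≤* = ℕP.*-mono-≤

  positive-⊗ : ∀ {P Q} → Positive P → Positive Q → Positive (P ⊗ Q)
  positive-⊗ (positive {x} {y} {z} {w} x≥1 _   z≥1 z≤x w≤y)
             (positive {x′} {y′} {z′} {w′} x′≥1 y′≥1 _ _ _) =
    subst Positive (sym (⊗-ℕ x y z w x′ y′ z′ w′)) (positive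
      (ℕP.≤-trans (1≤* x≥1 x′≥1) (ℕP.m≤m+n _ _))
      (ℕP.≤-trans (1≤* x≥1 y′≥1) (ℕP.m≤m+n _ _))
      (ℕP.≤-trans (1≤* z≥1 x′≥1) (ℕP.m≤m+n _ _))
      (ℕP.+-mono-≤ (ℕP.*-monoˡ-≤ x′ z≤x) (ℕP.*-monoˡ-≤ z′ w≤y))
      (ℕP.+-mono-≤ (ℕP.*-monoˡ-≤ y′ z≤x) (ℕP.*-monoˡ-≤ w′ w≤y)))

  Mv-positive : ∀ {v} → + 1 ≤ v → Positive (Mv v)
  Mv-positive (+≤+ v≥1) = positive v≥1 (s≤s z≤n) (s≤s z≤n) v≥1 z≤n

  prodM-positive : ∀ v vs → All (+ 1 ≤_) (v ∷ vs) → Positive (prodM (v ∷ vs))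
  prodM-positive v []        (v≥1 ∷ [])  = subst Positive (sym (⊗-identityʳ (Mv v))) (Mv-positive v≥1)
  prodM-positive v (u ∷ us)  (v≥1 ∷ us≥1) = positive-⊗ (Mv-positive v≥1) (prodM-positive u us us≥1)

  tr-positive : ∀ {P} → Positive P → + 1 ≤ tr P
  tr-positive (positive {x} {w = w} x≥1 _ _ _ _) = +≤+ (ℕP.≤-trans x≥1 (ℕP.m≤m+n x w))

  tr-⊗-ℕ : ∀ x y z w x′ y′ z′ w′ →
    tr (mat (+ x) (+ y) (+ z) (+ w) ⊗ mat (+ x′) (+ y′) (+ z′) (+ w′))
    ≡ + ((x ℕ.* x′ ℕ.+ y ℕ.* z′) ℕ.+ (z ℕ.* y′ ℕ.+ w ℕ.* w′))
  tr-⊗-ℕ x y z w x′ y′ z′ w′ = cong tr (⊗-ℕ x y z w x′ y′ z′ w′)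

  tr-mono : ∀ {P Q} → Positive P → Positive Q → tr P ≤ tr (P ⊗ Q)
  tr-mono (positive {x} {y} {z} {w} _ _ _ _ w≤y)
          (positive {x′} {y′} {z′} {w′} x′≥1 _ z′≥1 _ _) =
    subst (+ (x ℕ.+ w) ≤_) (sym (tr-⊗-ℕ x y z w x′ y′ z′ w′)) (+≤+ (ℕP.≤-trans
      (ℕP.+-mono-≤ (ℕP.m≤m*n x x′ {{ℕ.>-nonZero x′≥1}})
                  (ℕP.≤-trans w≤y (ℕP.m≤m*n y z′ {{ℕ.>-nonZero z′≥1}})))
      (ℕP.m≤m+n _ _)))

  tr-⊗≥3 : ∀ {P Q} → Positive P → Positive Q → + 3 ≤ tr (P ⊗ Q)
  tr-⊗≥3 (positive {x} {y} {z} {w} x≥1 y≥1 z≥1 _ _)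
         (positive {x′} {y′} {z′} {w′} x′≥1 y′≥1 z′≥1 _ _) =
    subst (+ 3 ≤_) (sym (tr-⊗-ℕ x y z w x′ y′ z′ w′)) (+≤+
      (ℕP.+-mono-≤ (ℕP.+-mono-≤ (1≤* x≥1 x′≥1) (1≤* y≥1 z′≥1)) (ℕP.≤-trans (1≤* z≥1 y′≥1) (ℕP.m≤m+n _ _))))

  data Extension (B C P Q : M2) : Set where
    appended  : P ≡ C ⊗ B → Q ≡ P ⊗ B → Extension B C P Q
    prepended : P ≡ B ⊗ C → Q ≡ B ⊗ P → Extension B C P Q

  fricke-step : ∀ {B C P Q} → Extension B C P Q → tr Q ≡ tr P * tr B - det B * tr C
  fricke-step {B} {C} (appended refl refl) = fricke C B
  fricke-step {B} {C} (prepended refl refl) = begin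
    tr (B ⊗ (B ⊗ C))                  ≡⟨ tr-comm B (B ⊗ C) ⟩
    tr ((B ⊗ C) ⊗ B)                  ≡⟨ cong tr (⊗-assoc B C B) ⟩
    tr (B ⊗ (C ⊗ B))                  ≡⟨ tr-comm B (C ⊗ B) ⟩
    tr ((C ⊗ B) ⊗ B)                  ≡⟨ fricke C B ⟩
    tr (C ⊗ B) * tr B - det B * tr C  ≡⟨ cong (λ t → t * tr B - det B * tr C) (tr-comm C B) ⟩
    tr (B ⊗ C) * tr B - det B * tr C  ∎
    where open ≡-Reasoning

  tr-factor : ∀ {B C P Q} → Extension B C P Q → Positive B → Positive C → tr C ≤ tr P
  tr-factor         (appended refl _)  B⁺ C⁺ = tr-mono C⁺ B⁺
  tr-factor {B} {C} (prepended refl _) B⁺ C⁺ = subst (tr C ≤_) (tr-comm C B) (tr-mono C⁺ B⁺)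

open import Defs
open import Data.Nat as ℕ using (ℕ; _≤_; _∸_; suc; z≤n; s≤s)
import Data.Nat.Properties as ℕP
open import Data.Integer as ℤ using (ℤ; +_; -_; _-_; _*_; _+_; _^_; +≤+)
import Data.Integer.Properties as ℤP
open import Data.Integer.Tactic.RingSolver using (solve-∀)
open import Data.List using ([]; _∷_; _++_; map)
open import Data.List.Properties using (map-++; length-map)
open import Data.List.Relation.Unary.All using (All; _∷_; universal)
open import Data.List.Relation.Unary.All.Properties using (map⁺)
open import Data.Product as Prod using (_×_; _,_)
open import Data.Sum as Sum using (_⊎_; inj₁; inj₂; [_,_]′)
open import Function using (_∘_)
open import Relation.Binary.PropositionalEquality as Eq using (_≡_; refl; sym; trans; cong; cong₂)

open FareyWords using (Neighbours; neighbours; christoffel-mediant; mechFrom-length;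
  neighbours-same-denominator; neighbours-numeratorˡ; neighbours-numeratorʳ;
  neighbours-differenceˡ; neighbours-differenceʳ)
open TraceMatrices

difference-one : ∀ m n → + m - + n ≡ + 1 → m ≡ suc n
difference-one m n e = ℤP.+-injective (trans (split (+ m) (+ n)) (cong (_+ + n) e))
  where
  split : ∀ u v → u ≡ (u - v) + v
  split = solve-∀

difference-minus-one : ∀ m n → + m - + n ≡ - + 1 → n ≡ suc m
difference-minus-one m n e = difference-one n m (trans (swap (+ m) (+ n)) (cong -_ e))
  where
  swap : ∀ u v → v - u ≡ - (u - v)
  swap = solve-∀

unimodular-neighbours : ∀ {p q p′ q′} →
  (+ (p ℕ.* q′) - + (p′ ℕ.* q) ≡ + 1) ⊎ (+ (p ℕ.* q′) - + (p′ ℕ.* q) ≡ - + 1) →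
  Neighbours p q p′ q′ ⊎ Neighbours p′ q′ p q
unimodular-neighbours (inj₁ e) = inj₂ (neighbours (difference-one _ _ e))
unimodular-neighbours (inj₂ e) = inj₁ (neighbours (difference-minus-one _ _ e))

sign-cases : ∀ q → 1 ≤ q → (- + 1) ^ q ≡ - + 1 ⊎ ((- + 1) ^ q ≡ + 1 × 2 ≤ q)
sign-cases (suc ℕ.zero)          _ = inj₁ refl
sign-cases (suc (suc ℕ.zero))    _ = inj₂ (refl , s≤s (s≤s z≤n))
sign-cases (suc (suc (suc j)))   _ with sign-cases (suc j) (s≤s z≤n)
... | inj₁ e       = inj₁ (cong (λ t → - + 1 * (- + 1 * t)) e)
... | inj₂ (e , _) = inj₂ (cong (λ t → - + 1 * (- + 1 * t)) e , s≤s (s≤s z≤n))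

double : ∀ u → u + u ≡ u * + 3 - u
double = solve-∀

plus-as-minus : ∀ u v → u + v ≡ u - - + 1 * v
plus-as-minus = solve-∀

-- The inequality t₁ + 1 ≤ t₁ t₂ − ε t₃ behind T(w_{(p+p′)/(q+q′)}) ≥ T(w_{p/q}) + 1,
-- for ε = −1 (odd q′) and for ε = 1 (even q′, where t₂ ≥ 3 and t₃ ≤ t₁).
growth-odd : ∀ {t₁ t₂ t₃} → + 0 ℤ.≤ t₁ → + 1 ℤ.≤ t₂ → + 1 ℤ.≤ t₃ → t₁ + + 1 ℤ.≤ t₁ * t₂ - - + 1 * t₃
growth-odd {t₁} {t₂} {t₃} (+≤+ _) t₂≥1 t₃≥1 = begin   -- t₁ is now + n, visibly nonnegative
  t₁ + + 1              ≤⟨ ℤP.+-mono-≤ t₁≤t₁t₂ t₃≥1 ⟩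
  t₁ * t₂ + t₃          ≡⟨ plus-as-minus (t₁ * t₂) t₃ ⟩
  t₁ * t₂ - - + 1 * t₃  ∎
  where
  open ℤP.≤-Reasoning
  t₁≤t₁t₂ : t₁ ℤ.≤ t₁ * t₂
  t₁≤t₁t₂ = ℤP.≤-trans (ℤP.≤-reflexive (sym (ℤP.*-identityʳ t₁))) (ℤP.*-monoˡ-≤-nonNeg t₁ t₂≥1)

growth-even : ∀ {t₁ t₂ t₃} → + 1 ℤ.≤ t₃ → t₃ ℤ.≤ t₁ → + 3 ℤ.≤ t₂ → t₁ + + 1 ℤ.≤ t₁ * t₂ - + 1 * t₃
growth-even {t₁} {t₂} {t₃} t₃≥1 t₃≤t₁ t₂≥3 with ℤP.≤-trans t₃≥1 t₃≤t₁
... | t₁≥1@(+≤+ _) = begin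
  t₁ + + 1            ≤⟨ ℤP.+-monoʳ-≤ t₁ t₁≥1 ⟩
  t₁ + t₁             ≡⟨ double t₁ ⟩
  t₁ * + 3 - t₁       ≤⟨ ℤP.+-monoˡ-≤ (- t₁) (ℤP.*-monoˡ-≤-nonNeg t₁ t₂≥3) ⟩
  t₁ * t₂ - t₁        ≤⟨ ℤP.+-monoʳ-≤ (t₁ * t₂) (ℤP.neg-mono-≤ t₃≤t₁) ⟩
  t₁ * t₂ - t₃        ≡⟨ cong (λ u → t₁ * t₂ - u) (sym (ℤP.*-identityˡ t₃)) ⟩
  t₁ * t₂ - + 1 * t₃  ∎
  where open ℤP.≤-Reasoning

growth : ∀ {t₁ t₂ t₃ ε} → + 1 ℤ.≤ t₃ → t₃ ℤ.≤ t₁ → + 1 ℤ.≤ t₂ →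
  ε ≡ - + 1 ⊎ (ε ≡ + 1 × + 3 ℤ.≤ t₂) → t₁ + + 1 ℤ.≤ t₁ * t₂ - ε * t₃
growth t₃≥1 t₃≤t₁ t₂≥1 (inj₁ refl) =
  growth-odd (ℤP.≤-trans (+≤+ z≤n) (ℤP.≤-trans t₃≥1 t₃≤t₁)) t₂≥1 t₃≥1
growth t₃≥1 t₃≤t₁ _ (inj₂ (refl , t₂≥3)) = growth-even t₃≥1 t₃≤t₁ t₂≥3

pair-identity : ∀ u v →
  (u * (v * + 1 + + 1 * + 0) + + 1 * (+ 1 * + 1 + + 0 * + 0)) + (+ 1 * (v * + 0 + + 1 * + 1) + + 0 * (+ 1 * + 0 + + 0 * + 1))
  ≡ ((u * + 1 + + 1 * + 0) + (+ 1 * + 0 + + 0 * + 1)) * ((v * + 1 + + 1 * + 0) + (+ 1 * + 0 + + 0 * + 1)) - - + 1 * (+ 1 + + 1)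
pair-identity = solve-∀

T-pair : ∀ u v → T (u ∷ v ∷ []) ≡ T (u ∷ []) * T (v ∷ []) - - + 1 * T []
T-pair = pair-identity

Conclusion : ℤ → ℤ → ℕ → ℕ → ℕ → ℕ → Set
Conclusion a b p q p′ q′ =
  (Tw a b (p ℕ.+ p′) (q ℕ.+ q′) ≡ Tw a b p q * Tw a b p′ q′ - (- + 1) ^ q′ * Tw a b (p ∸ p′) (q ∸ q′))
  × (Tw a b p q + + 1 ℤ.≤ Tw a b (p ℕ.+ p′) (q ℕ.+ q′))

Mw : ℤ → ℤ → ℕ → ℕ → M2
Mw a b p q = prodM (map (subst a b) (christoffel p q))

module ChristoffelMatrices (a b : ℤ) (a≥1 : + 1 ℤ.≤ a) (b≥1 : + 1 ℤ.≤ b) where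

  Mw-mediant : ∀ {x y x′ y′} → 1 ≤ y → 1 ≤ y′ → Neighbours x y x′ y′ →
    Mw a b (x ℕ.+ x′) (y ℕ.+ y′) ≡ Mw a b x y ⊗ Mw a b x′ y′
  Mw-mediant {x} {y} {x′} {y′} y≥1 y′≥1 nb = begin
    prodM (map f (christoffel (x ℕ.+ x′) (y ℕ.+ y′)))
      ≡⟨ cong (prodM ∘ map f) (christoffel-mediant y≥1 y′≥1 nb) ⟩
    prodM (map f (christoffel x y ++ christoffel x′ y′))
      ≡⟨ cong prodM (map-++ f (christoffel x y) (christoffel x′ y′)) ⟩
    prodM (map f (christoffel x y) ++ map f (christoffel x′ y′))
      ≡⟨ prodM-++ (map f (christoffel x y)) (map f (christoffel x′ y′)) ⟩
    Mw a b x y ⊗ Mw a b x′ y′ ∎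
    where
    open Eq.≡-Reasoning
    f = subst a b

  det-Mw : ∀ p q → det (Mw a b p q) ≡ (- + 1) ^ q
  det-Mw p q = trans (det-prodM (map (subst a b) (christoffel p q)))
    (cong ((- + 1) ^_) (trans (length-map (subst a b) (christoffel p q)) (mechFrom-length p q 1 q)))

  letters-positive : ∀ w → All (+ 1 ℤ.≤_) (map (subst a b) w)
  letters-positive w = map⁺ (universal letter-positive w)
    where
    letter-positive : ∀ l → + 1 ℤ.≤ subst a b l
    letter-positive 𝕒 = a≥1
    letter-positive 𝕓 = b≥1

  Mw-positive : ∀ p q → 1 ≤ q → Positive (Mw a b p q)
  Mw-positive p (suc k) _ = prodM-positive _ _ (letters-positive (christoffel p (suc k)))

  Tw≥1 : ∀ p q → 1 ≤ q → + 1 ℤ.≤ Tw a b p q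
  Tw≥1 p q q≥1 = tr-positive (Mw-positive p q q≥1)

  Tw≥3 : ∀ p q → 2 ≤ q → + 3 ℤ.≤ Tw a b p q
  Tw≥3 p (suc (suc k)) (s≤s (s≤s z≤n)) with letters-positive (christoffel p (suc (suc k)))
  ... | v≥1 ∷ vs≥1 = tr-⊗≥3 (Mv-positive v≥1) (prodM-positive _ _ vs≥1)

  -- Denominators q = q′ = 1: the pair is {0/1, 1/1}, and the mediant word is ab.
  unit-case : ∀ p p′ → p ≤ 1 → p′ ≤ 1 → Neighbours p 1 p′ 1 ⊎ Neighbours p′ 1 p 1 →
    Conclusion a b p 1 p′ 1
  unit-case 0 0 _ _ (inj₁ (neighbours ()))
  unit-case 0 0 _ _ (inj₂ (neighbours ()))
  unit-case 1 1 _ _ (inj₁ (neighbours ()))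
  unit-case 1 1 _ _ (inj₂ (neighbours ()))
  unit-case 0 1 _ _ _ = identity ,
    Eq.subst (Tw a b 0 1 + + 1 ℤ.≤_) (sym identity)
      (growth-odd (ℤP.≤-trans (+≤+ z≤n) (Tw≥1 0 1 (s≤s z≤n))) (Tw≥1 1 1 (s≤s z≤n)) (+≤+ (s≤s z≤n)))
    where
    identity : Tw a b 1 2 ≡ Tw a b 0 1 * Tw a b 1 1 - (- + 1) ^ 1 * Tw a b 0 0
    identity = T-pair a b
  unit-case 1 0 _ _ _ = identity ,
    Eq.subst (Tw a b 1 1 + + 1 ℤ.≤_) (sym identity)
      (growth-odd (ℤP.≤-trans (+≤+ z≤n) (Tw≥1 1 1 (s≤s z≤n))) (Tw≥1 0 1 (s≤s z≤n)) (+≤+ (s≤s z≤n)))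
    where
    identity : Tw a b 1 2 ≡ Tw a b 1 1 * Tw a b 0 1 - (- + 1) ^ 1 * Tw a b 1 0
    identity = trans (T-pair a b) (cong (λ t → t - - + 1 * + 2) (ℤP.*-comm (Tw a b 0 1) (Tw a b 1 1)))
  unit-case (suc (suc _)) _ (s≤s ()) _ _
  unit-case _ (suc (suc _)) _ (s≤s ()) _

  mediant-case : ∀ {p q p′ q′} → 1 ≤ q′ → q′ ℕ.< q →
    Neighbours p q p′ q′ ⊎ Neighbours p′ q′ p q → Conclusion a b p q p′ q′
  mediant-case {p} {q} {p′} {q′} q′≥1 q′<q nb =
    trace-identity ,
    Eq.subst (tr P + + 1 ℤ.≤_) (sym trace-identity)
      (growth (tr-positive C⁺) (tr-factor extension B⁺ C⁺) (tr-positive B⁺) sign)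
    where
    q′≤q = ℕP.<⇒≤ q′<q
    q≥1 = ℕP.≤-trans q′≥1 q′≤q
    d≥1 : 1 ≤ q ∸ q′
    d≥1 = ℕP.m<n⇒0<n∸m q′<q
    p′≤p : p′ ≤ p
    p′≤p = [ (λ nb → neighbours-numeratorˡ nb q′≤q (ℕP.≤-trans (s≤s q′≥1) q′<q)) ,
             (λ nb → neighbours-numeratorʳ nb q′≤q) ]′ nb
    B = Mw a b p′ q′
    C = Mw a b (p ∸ p′) (q ∸ q′)
    P = Mw a b p q
    Q = Mw a b (p ℕ.+ p′) (q ℕ.+ q′)
    B⁺ = Mw-positive p′ q′ q′≥1
    C⁺ = Mw-positive (p ∸ p′) (q ∸ q′) d≥1
    extension-of : Neighbours p q p′ q′ ⊎ Neighbours p′ q′ p q → Extension B C P Q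
    extension-of (inj₁ nb) = appended
      (trans (sym (cong₂ (Mw a b) (ℕP.m∸n+n≡m p′≤p) (ℕP.m∸n+n≡m q′≤q)))
             (Mw-mediant d≥1 q′≥1 (neighbours-differenceˡ nb p′≤p q′≤q)))
      (Mw-mediant q≥1 q′≥1 nb)
    extension-of (inj₂ nb) = prepended
      (trans (sym (cong₂ (Mw a b) (ℕP.m+[n∸m]≡n p′≤p) (ℕP.m+[n∸m]≡n q′≤q)))
             (Mw-mediant q′≥1 d≥1 (neighbours-differenceʳ nb p′≤p q′≤q)))
      (trans (cong₂ (Mw a b) (ℕP.+-comm p p′) (ℕP.+-comm q q′)) (Mw-mediant q′≥1 q≥1 nb))
    extension : Extension B C P Q
    extension = extension-of nb
    trace-identity : tr Q ≡ tr P * tr B - (- + 1) ^ q′ * tr C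
    trace-identity = trans (fricke-step extension) (cong (λ ε → tr P * tr B - ε * tr C) (det-Mw p′ q′))
    sign : (- + 1) ^ q′ ≡ - + 1 ⊎ ((- + 1) ^ q′ ≡ + 1 × + 3 ℤ.≤ tr B)
    sign = Sum.map₂ (Prod.map₂ (Tw≥3 p′ q′)) (sign-cases q′ q′≥1)

  neighbours-fricke : ∀ {p q p′ q′} → 1 ≤ q′ → p ≤ q → p′ ≤ q′ → q′ ≤ q →
    Neighbours p q p′ q′ ⊎ Neighbours p′ q′ p q → Conclusion a b p q p′ q′
  neighbours-fricke {p} {q} {p′} {q′} q′≥1 p≤q p′≤q′ q′≤q nb with ℕP.m≤n⇒m<n∨m≡n q′≤q
  ... | inj₁ q′<q = mediant-case q′≥1 q′<q nb
  ... | inj₂ refl with [ neighbours-same-denominator , neighbours-same-denominator ]′ nb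
  ...   | refl = unit-case p p′ p≤q p′≤q′ nb

-- The theorem: the determinant condition makes p/q and p′/q′ Farey neighbours,
-- and a < b only serves to make b positive.
lemma4p3 : (a b : ℤ) → + 1 ℤ.≤ a → a ℤ.< b →
    (p q p′ q′ : ℕ) → 1 ≤ q → 1 ≤ q′ → p ≤ q → p′ ≤ q′ →
    ((+ (p ℕ.* q′) - + (p′ ℕ.* q) ≡ + 1) ⊎ (+ (p ℕ.* q′) - + (p′ ℕ.* q) ≡ - + 1)) →
    q′ ≤ q →
    (Tw a b (p ℕ.+ p′) (q ℕ.+ q′)
        ≡ Tw a b p q * Tw a b p′ q′ - (- + 1) ^ q′ * Tw a b (p ∸ p′) (q ∸ q′))
    × (Tw a b p q + + 1 ℤ.≤ Tw a b (p ℕ.+ p′) (q ℕ.+ q′))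
lemma4p3 a b a≥1 a<b p q p′ q′ _ q′≥1 p≤q p′≤q′ unimodular q′≤q =
  neighbours-fricke q′≥1 p≤q p′≤q′ q′≤q (unimodular-neighbours unimodular)
  where
  open ChristoffelMatrices a b a≥1 (ℤP.≤-trans a≥1 (ℤP.<⇒≤ a<b))
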